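{- $\mathsf{RT}^1_{<\infty}\le_\mathrm{sW}\mathsf{wRSg}$.
   Context: Problems are multi-valued partial functions $\subseteq\omega^\omega\rightrightarrows\omega^\omega$ with standard codings. $\mathcal{F}\le_\mathrm{sW}\mathcal{G}$ if there are Turing functionals $\Phi,\Psi$ with $\Phi(f)\in\mathrm{dom}(\mathcal{G})$ for all $f\in\mathrm{dom}(\mathcal{F})$ and $\Psi(g)\in\mathcal{F}(f)$ for all $f\in\mathrm{dom}(\mathcal F)$, $g\in\mathcal{G}(\Phi(f))$. $\mathsf{RT}^1_{<\infty}$: input $c\colon\omega\to\omega$ with finite range; output an infinite $H\subseteq\omega$ on which $c$ is constant. Graphs $G=(V,E)$ are simple with $V\subseteq\omega$ infinite, $E\subseteq[V]^2$; $N(v)=\{y:(v,y)\in E\}$. $\mathsf{wRSg}$: input an infinite graph $G=(V,E)$; output an infinite $H\subseteq V$ with, for all $v\in H$, $|H\cap N(v)|=\omega$ or $|H\cap N(v)|\le1$. -}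

module Defs where

open import Data.Nat using (ℕ; zero; suc; _+_; _*_; _≤_; _<_; ⌊_/2⌋)
open import Data.List using (List; []; _∷_)
open import Data.Maybe using (Maybe; just; nothing; _>>=_)
open import Data.Product using (Σ; ∃; ∃-syntax; _×_; _,_)
open import Data.Sum using (_⊎_)
open import Relation.Binary.PropositionalEquality using (_≡_)
open import Relation.Nullary using (¬_)

-- Turing functionals: oracle μ-recursive codes, evaluated with fuel.

data Code : Set where
  zeroC   : Code
  succC   : Code
  proj    : ℕ → Code
  oracle  : Code
  comp    : Code → List Code → Code
  primrec : Code → Code → Code
  mu      : Code → Code

hd : List ℕ → ℕ
hd []      = 0
hd (x ∷ _) = x

tl : List ℕ → List ℕ
tl []       = []
tl (_ ∷ xs) = xs

nth : ℕ → List ℕ → ℕ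
nth _       []       = 0
nth zero    (x ∷ _)  = x
nth (suc i) (_ ∷ xs) = nth i xs

mutual
  eval : ℕ → Code → (ℕ → ℕ) → List ℕ → Maybe ℕ
  eval zero    _             _ _  = nothing
  eval (suc s) zeroC         f xs = just 0
  eval (suc s) succC         f xs = just (suc (hd xs))
  eval (suc s) (proj i)      f xs = just (nth i xs)
  eval (suc s) oracle        f xs = just (f (hd xs))
  eval (suc s) (comp g hs)   f xs = evalList s hs f xs >>= λ ys → eval s g f ys
  eval (suc s) (primrec g h) f xs = prAux s g h f (tl xs) (hd xs)
  eval (suc s) (mu g)        f xs = muAux s g f xs 0

  evalList : ℕ → List Code → (ℕ → ℕ) → List ℕ → Maybe (List ℕ)
  evalList s []       f xs = just []
  evalList s (h ∷ hs) f xs =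
    eval s h f xs >>= λ y → evalList s hs f xs >>= λ ys → just (y ∷ ys)

  prAux : ℕ → Code → Code → (ℕ → ℕ) → List ℕ → ℕ → Maybe ℕ
  prAux s g h f xs zero    = eval s g f xs
  prAux s g h f xs (suc n) = prAux s g h f xs n >>= λ r → eval s h f (n ∷ r ∷ xs)

  muAux : ℕ → Code → (ℕ → ℕ) → List ℕ → ℕ → Maybe ℕ
  muAux zero    g f xs k = nothing
  muAux (suc s) g f xs k = eval s g f (k ∷ xs) >>= λ where
    zero    → just k
    (suc _) → muAux s g f xs (suc k)

_⟦_⟧_↓_ : Code → (ℕ → ℕ) → ℕ → ℕ → Set
Φ ⟦ f ⟧ n ↓ v = ∃[ s ] (eval s Φ f (n ∷ []) ≡ just v)

_⟦_⟧≡_ : Code → (ℕ → ℕ) → (ℕ → ℕ) → Set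
Φ ⟦ f ⟧≡ p = ∀ n → Φ ⟦ f ⟧ n ↓ p n

-- Sets of naturals, coded by characteristic functions (x ∈ H iff h x ≡ 1).

IsChar : (ℕ → ℕ) → Set
IsChar h = ∀ n → h n ≤ 1

Infinite : (ℕ → Set) → Set
Infinite P = ∀ n → ∃[ m ] (n ≤ m × P m)

FiniteRange : (ℕ → ℕ) → Set
FiniteRange c = ∃[ k ] (∀ n → c n < k)

RT1Sol : (ℕ → ℕ) → (ℕ → ℕ) → Set
RT1Sol c h = IsChar h × Infinite (λ x → h x ≡ 1)
           × (∀ x y → h x ≡ 1 → h y ≡ 1 → c x ≡ c y)

-- Graphs, coded by p : ω → ω with
--   x ∈ V   iff p (2x) ≡ 1,
--   (x,y) ∈ E iff p (2⟨x,y⟩+1) ≡ 1, ⟨_,_⟩ Cantor pairing.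

pair : ℕ → ℕ → ℕ
pair x y = ⌊ (x + y) * suc (x + y) /2⌋ + y

Vtx : (ℕ → ℕ) → ℕ → Set
Vtx p x = p (2 * x) ≡ 1

Edge : (ℕ → ℕ) → ℕ → ℕ → Set
Edge p x y = p (suc (2 * pair x y)) ≡ 1

IsGraph : (ℕ → ℕ) → Set
IsGraph p = IsChar p
          × (∀ x y → Edge p x y → Edge p y x)
          × (∀ x → ¬ Edge p x x)
          × (∀ x y → Edge p x y → Vtx p x × Vtx p y)
          × Infinite (Vtx p)

wRSgSol : (ℕ → ℕ) → (ℕ → ℕ) → Set
wRSgSol p h = IsChar h × (∀ x → h x ≡ 1 → Vtx p x) × Infinite (λ x → h x ≡ 1)
  × (∀ v → h v ≡ 1 →
       Infinite (λ y → h y ≡ 1 × Edge p v y)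
       ⊎ (∀ y z → h y ≡ 1 → Edge p v y → h z ≡ 1 → Edge p v z → y ≡ z))

record Problem : Set₁ where
  field
    dom : (ℕ → ℕ) → Set
    sol : (ℕ → ℕ) → (ℕ → ℕ) → Set   -- sol f g : g ∈ F(f)

open Problem public

_≤sW_ : Problem → Problem → Set
F ≤sW G = ∃[ Φ ] ∃[ Ψ ]
  (∀ f → dom F f →
     ∃[ p ] (Φ ⟦ f ⟧≡ p × dom G p ×
       (∀ g → sol G p g → ∃[ h ] (Ψ ⟦ g ⟧≡ h × sol F f h))))

RT1<∞ : Problem
RT1<∞ = record { dom = FiniteRange ; sol = RT1Sol }

wRSg : Problem
wRSg = record { dom = IsGraph ; sol = wRSgSol }

module Submission where

-- A colouring c : ℕ → ℕ with finitely many colours is sent to its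
-- graph of colour classes: the vertices are the names ⟨n, c n⟩ (Cantor pairing), one for
-- each n, and two distinct vertices are adjacent iff they carry the same colour.  Thus the
-- colour of a vertex can be read off its name, which is what makes the reduction strong.
--
-- Let H be a wRSg-solution.  H is infinite, so by the pigeonhole
-- principle it contains three vertices ⟨m₁,a⟩, ⟨m₂,a⟩, ⟨m₃,a⟩ of one colour a; Ψ finds
-- such an a by unbounded search using only the oracle H.  Then ⟨m₁,a⟩ has at least two
-- H-neighbours, so by the wRSg property it has infinitely many; they all have colour a,
-- so the column {n | ⟨n,a⟩ ∈ H} is an infinite c-homogeneous set, and Ψ outputs it.

open import Defs
open import Data.Nat using (ℕ; zero; suc; _+_; _*_; _∸_; _≤_; _<_; z≤n; s≤s; z<s; pred; _⊔_; ⌊_/2⌋; _≤′_; ≤′-refl; ≤′-step; _≰_; _≤?_; _≟_)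
open import Data.Nat.Tactic.RingSolver using (solve-∀)
open import Data.Nat.Properties
open import Data.List using (List; []; _∷_)
open import Data.Maybe using (Maybe; just; nothing; _>>=_)
open import Data.Product using (∃; ∃-syntax; _×_; _,_; proj₁; proj₂)
open import Data.Sum using (_⊎_; inj₁; inj₂)
open import Data.Empty using (⊥-elim)
open import Relation.Nullary using (¬_; yes; no)
open import Relation.Binary using (tri<; tri≈; tri>)
open import Relation.Binary.PropositionalEquality

bind-just : ∀ {A B : Set} {m : Maybe A} {a : A} {k : A → Maybe B} →
            m ≡ just a → (m >>= k) ≡ k a
bind-just refl = refl

bind-inv : ∀ {A B : Set} (m : Maybe A) {k : A → Maybe B} {v : B} →
           (m >>= k) ≡ just v → ∃[ a ] (m ≡ just a × k a ≡ just v)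
bind-inv (just a) e = a , refl , e

mutual
  eval-step : ∀ s c f xs {v} → eval s c f xs ≡ just v → eval (suc s) c f xs ≡ just v
  eval-step (suc s) zeroC         f xs e = e
  eval-step (suc s) succC         f xs e = e
  eval-step (suc s) (proj i)      f xs e = e
  eval-step (suc s) oracle        f xs e = e
  eval-step (suc s) (comp g hs)   f xs e with bind-inv (evalList s hs f xs) e
  ... | ys , e₁ , e₂ = trans (bind-just (evalList-step s hs f xs e₁)) (eval-step s g f ys e₂)
  eval-step (suc s) (primrec g h) f xs e = prAux-step s g h f (tl xs) (hd xs) e
  eval-step (suc s) (mu g)        f xs e = muAux-step s g f xs 0 e

  evalList-step : ∀ s hs f xs {vs} → evalList s hs f xs ≡ just vs → evalList (suc s) hs f xs ≡ just vs
  evalList-step s []       f xs e = e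
  evalList-step s (h ∷ hs) f xs e with bind-inv (eval s h f xs) e
  ... | y , e₁ , e₂ with bind-inv (evalList s hs f xs) e₂
  ... | ys , e₃ , e₄ =
    trans (bind-just (eval-step s h f xs e₁)) (trans (bind-just (evalList-step s hs f xs e₃)) e₄)

  prAux-step : ∀ s g h f xs n {v} → prAux s g h f xs n ≡ just v → prAux (suc s) g h f xs n ≡ just v
  prAux-step s g h f xs zero    e = eval-step s g f xs e
  prAux-step s g h f xs (suc n) e with bind-inv (prAux s g h f xs n) e
  ... | r , e₁ , e₂ = trans (bind-just (prAux-step s g h f xs n e₁)) (eval-step s h f (n ∷ r ∷ xs) e₂)

  muAux-step : ∀ s g f xs k {v} → muAux s g f xs k ≡ just v → muAux (suc s) g f xs k ≡ just v
  muAux-step (suc s) g f xs k e with bind-inv (eval s g f (k ∷ xs)) e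
  ... | zero  , e₁ , e₂ = trans (bind-just (eval-step s g f (k ∷ xs) e₁)) e₂
  ... | suc _ , e₁ , e₂ = trans (bind-just (eval-step s g f (k ∷ xs) e₁)) (muAux-step s g f xs (suc k) e₂)

more-fuel : (P : ℕ → Set) → (∀ s → P s → P (suc s)) → ∀ {s s'} → s ≤ s' → P s → P s'
more-fuel P step {s} le p = go (≤⇒≤′ le)
  where
  go : ∀ {s'} → s ≤′ s' → P s'
  go ≤′-refl      = p
  go (≤′-step le') = step _ (go le')

eval-mono : ∀ {c f xs v s s'} → s ≤ s' → eval s c f xs ≡ just v → eval s' c f xs ≡ just v
eval-mono {c} {f} {xs} {v} = more-fuel (λ s → eval s c f xs ≡ just v) (λ s → eval-step s c f xs)

evalList-mono : ∀ {hs f xs vs s s'} → s ≤ s' → evalList s hs f xs ≡ just vs → evalList s' hs f xs ≡ just vs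
evalList-mono {hs} {f} {xs} {vs} = more-fuel (λ s → evalList s hs f xs ≡ just vs) (λ s → evalList-step s hs f xs)

prAux-mono : ∀ {g h f xs n v s s'} → s ≤ s' → prAux s g h f xs n ≡ just v → prAux s' g h f xs n ≡ just v
prAux-mono {g} {h} {f} {xs} {n} {v} = more-fuel (λ s → prAux s g h f xs n ≡ just v) (λ s → prAux-step s g h f xs n)

muAux-mono : ∀ {g f xs k v s s'} → s ≤ s' → muAux s g f xs k ≡ just v → muAux s' g f xs k ≡ just v
muAux-mono {g} {f} {xs} {k} {v} = more-fuel (λ s → muAux s g f xs k ≡ just v) (λ s → muAux-step s g f xs k)

-- Convergence certificates: the code c with oracle f on arguments xs halts with value v.
-- (A record rather than a Σ-type, so that c, f, xs, v can be inferred from the type.)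
record Conv (c : Code) (f : ℕ → ℕ) (xs : List ℕ) (v : ℕ) : Set where
  constructor _,_
  field
    fuel : ℕ
    prf  : eval fuel c f xs ≡ just v

record ConvList (hs : List Code) (f : ℕ → ℕ) (xs : List ℕ) (vs : List ℕ) : Set where
  constructor _,_
  field
    fuel : ℕ
    prf  : evalList fuel hs f xs ≡ just vs

conv-↓ : ∀ {c f n v} → Conv c f (n ∷ []) v → c ⟦ f ⟧ n ↓ v
conv-↓ (s , e) = s , e

conv-cast : ∀ {c f xs v w} → v ≡ w → Conv c f xs v → Conv c f xs w
conv-cast refl p = p

conv-[] : ∀ {f xs} → ConvList [] f xs []
conv-[] = 0 , refl

conv-∷ : ∀ {h hs f xs y ys} → Conv h f xs y → ConvList hs f xs ys → ConvList (h ∷ hs) f xs (y ∷ ys)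
conv-∷ {h} {hs} (s₁ , e₁) (s₂ , e₂) =
  s₁ ⊔ s₂ , trans (bind-just (eval-mono {c = h} (m≤m⊔n s₁ s₂) e₁))
                  (bind-just (evalList-mono {hs = hs} (m≤n⊔m s₁ s₂) e₂))

conv-comp : ∀ {g hs f xs ys v} → ConvList hs f xs ys → Conv g f ys v → Conv (comp g hs) f xs v
conv-comp {g} {hs} (s₁ , e₁) (s₂ , e₂) =
  suc (s₁ ⊔ s₂) , trans (bind-just (evalList-mono {hs = hs} (m≤m⊔n s₁ s₂) e₁))
                        (eval-mono {c = g} (m≤n⊔m s₁ s₂) e₂)

conv-zero : ∀ {f xs} → Conv zeroC f xs 0
conv-zero = 1 , refl

conv-succ : ∀ {f xs} → Conv succC f xs (suc (hd xs))
conv-succ = 1 , refl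

conv-proj : ∀ {f xs} i → Conv (proj i) f xs (nth i xs)
conv-proj i = 1 , refl

conv-oracle : ∀ {f xs} → Conv oracle f xs (f (hd xs))
conv-oracle = 1 , refl

conv-primrec : ∀ {g h f ys} (R : ℕ → ℕ) → Conv g f ys (R 0) →
               (∀ n → Conv h f (n ∷ R n ∷ ys) (R (suc n))) →
               ∀ n → Conv (primrec g h) f (n ∷ ys) (R n)
conv-primrec {g} {h} {f} {ys} R base step n with iterate n
  where
  iterate : ∀ n → ∃[ s ] (prAux s g h f ys n ≡ just (R n))
  iterate zero    = Conv.fuel base , Conv.prf base
  iterate (suc n) with iterate n | step n
  ... | s₁ , e₁ | s₂ , e₂ =
    s₁ ⊔ s₂ , trans (bind-just (prAux-mono {g = g} {h} {f} {ys} {n} (m≤m⊔n s₁ s₂) e₁))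
                    (eval-mono {c = h} (m≤n⊔m s₁ s₂) e₂)
... | s , e = suc s , e

-- Unbounded search halts as soon as the total function computed by g has a zero:
-- it returns some zero of that function (not necessarily K itself).
conv-mu : ∀ {g f xs} (G : ℕ → ℕ) → (∀ k → Conv g f (k ∷ xs) (G k)) →
          ∀ K → G K ≡ 0 → ∃[ K' ] (Conv (mu g) f xs K' × G K' ≡ 0)
conv-mu {g} {f} {xs} G conv-g K GK≡0 with search K 0 (+-identityʳ K)
  where
  -- searching from j, at most d steps before reaching K
  search : ∀ d j → d + j ≡ K → ∃[ K' ] ((∃[ s ] (muAux s g f xs j ≡ just K')) × G K' ≡ 0)
  search d j d+j≡K with G j in Gj | conv-g j
  ... | zero  | s , e = j , (suc s , bind-just e) , Gj
  search zero    j refl | suc _ | _ = ⊥-elim (0≢1+n (trans (sym GK≡0) Gj))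
  search (suc d) j d+j≡K | suc _ | s₁ , e₁ with search d (suc j) (trans (+-suc d j) d+j≡K)
  ... | K' , (s₂ , e₂) , GK'≡0 =
    K' , (suc (s₁ ⊔ s₂) , trans (bind-just (eval-mono {c = g} (m≤m⊔n s₁ s₂) e₁))
                               (muAux-mono {g = g} {f} {xs} {suc j} (m≤n⊔m s₁ s₂) e₂)) , GK'≡0
... | K' , (s , e) , GK'≡0 = K' , (suc s , e) , GK'≡0

app₁ : Code → Code → Code
app₁ g e = comp g (e ∷ [])

app₂ : Code → Code → Code → Code
app₂ g e₁ e₂ = comp g (e₁ ∷ e₂ ∷ [])

conv-app₁ : ∀ {g e f xs a} {G : ℕ → ℕ} → (∀ a → Conv g f (a ∷ []) (G a)) →
            Conv e f xs a → Conv (app₁ g e) f xs (G a)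
conv-app₁ conv-g p = conv-comp (conv-∷ p conv-[]) (conv-g _)

conv-app₂ : ∀ {g e₁ e₂ f xs a b} {G : ℕ → ℕ → ℕ} → (∀ a b → Conv g f (a ∷ b ∷ []) (G a b)) →
            Conv e₁ f xs a → Conv e₂ f xs b → Conv (app₂ g e₁ e₂) f xs (G a b)
conv-app₂ conv-g p q = conv-comp (conv-∷ p (conv-∷ q conv-[])) (conv-g _ _)

ONE : Code
ONE = app₁ succC zeroC

conv-one : ∀ {f xs} → Conv ONE f xs 1
conv-one = conv-comp (conv-∷ conv-zero conv-[]) conv-succ

ADD : Code
ADD = primrec (proj 0) (app₁ succC (proj 1))

conv-add : ∀ {f} x y → Conv ADD f (x ∷ y ∷ []) (x + y)
conv-add x y = conv-primrec (_+ y) (conv-proj 0) (λ n → conv-app₁ (λ _ → conv-succ) (conv-proj 1)) x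

MUL : Code
MUL = primrec zeroC (app₂ ADD (proj 2) (proj 1))

conv-mul : ∀ {f} x y → Conv MUL f (x ∷ y ∷ []) (x * y)
conv-mul x y = conv-primrec (_* y) conv-zero (λ n → conv-app₂ conv-add (conv-proj 2) (conv-proj 1)) x

PRED : Code
PRED = primrec zeroC (proj 0)

conv-pred : ∀ {f} x → Conv PRED f (x ∷ []) (pred x)
conv-pred x = conv-primrec pred conv-zero (λ n → conv-proj 0) x

-- Truncated subtraction x ∸ y, by recursion on y.
MONUS : Code
MONUS = app₂ (primrec (proj 0) (app₁ PRED (proj 1))) (proj 1) (proj 0)

conv-monus : ∀ {f} x y → Conv MONUS f (x ∷ y ∷ []) (x ∸ y)
conv-monus x y = conv-app₂ countdown (conv-proj 1) (conv-proj 0)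
  where
  countdown : ∀ {f} n b → Conv (primrec (proj 0) (app₁ PRED (proj 1))) f (n ∷ b ∷ []) (b ∸ n)
  countdown n b = conv-primrec (b ∸_) (conv-proj 0)
    (λ k → conv-cast (pred[m∸n]≡m∸[1+n] b k) (conv-app₁ conv-pred (conv-proj 1))) n

-- Numbers as truth values: 0 is false, anything positive is true.
-- neg is negation, isEq is the equality test and truth normalises to 0/1;
-- + and * act as disjunction and conjunction.
neg : ℕ → ℕ
neg x = 1 ∸ x

isEq : ℕ → ℕ → ℕ
isEq x y = neg ((x ∸ y) + (y ∸ x))

truth : ℕ → ℕ
truth x = neg (neg x)

NEG : Code
NEG = app₂ MONUS ONE (proj 0)

conv-neg : ∀ {f} x → Conv NEG f (x ∷ []) (neg x)
conv-neg x = conv-app₂ conv-monus conv-one (conv-proj 0)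

ISEQ : Code
ISEQ = app₁ NEG (app₂ ADD (app₂ MONUS (proj 0) (proj 1)) (app₂ MONUS (proj 1) (proj 0)))

conv-isEq : ∀ {f} x y → Conv ISEQ f (x ∷ y ∷ []) (isEq x y)
conv-isEq x y = conv-app₁ conv-neg
  (conv-app₂ conv-add (conv-app₂ conv-monus (conv-proj 0) (conv-proj 1))
                      (conv-app₂ conv-monus (conv-proj 1) (conv-proj 0)))

TRUTH : Code
TRUTH = app₁ NEG (app₁ NEG (proj 0))

conv-truth : ∀ {f} x → Conv TRUTH f (x ∷ []) (truth x)
conv-truth x = conv-app₁ conv-neg (conv-app₁ conv-neg (conv-proj 0))

neg-pos : ∀ {x} → 0 < neg x → x ≡ 0
neg-pos {zero}  _ = refl
neg-pos {suc x} p = ⊥-elim (<-irrefl refl (subst (0 <_) (0∸n≡0 x) p))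

neg-of-pos : ∀ {x} → 0 < x → neg x ≡ 0
neg-of-pos {suc x} _ = 0∸n≡0 x

neg≡0 : ∀ x → neg x ≡ 0 → 0 < x
neg≡0 (suc x) _ = z<s

isEq-refl : ∀ x → isEq x x ≡ 1
isEq-refl x = cong (λ d → neg (d + d)) (n∸n≡0 x)

isEq-elim : ∀ {x y} → 0 < isEq x y → x ≡ y
isEq-elim {x} {y} p = ≤-antisym (m∸n≡0⇒m≤n (m+n≡0⇒m≡0 (x ∸ y) d≡0)) (m∸n≡0⇒m≤n (m+n≡0⇒n≡0 (x ∸ y) d≡0))
  where
  d≡0 : (x ∸ y) + (y ∸ x) ≡ 0
  d≡0 = neg-pos p

isEq-intro : ∀ {x y} → x ≡ y → 0 < isEq x y
isEq-intro {x} refl = subst (0 <_) (sym (isEq-refl x)) z<s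

isEq-≢ : ∀ {x y} → x ≢ y → isEq x y ≡ 0
isEq-≢ {x} {y} x≢y with isEq x y in e
... | zero  = refl
... | suc _ = ⊥-elim (x≢y (isEq-elim (subst (0 <_) (sym e) z<s)))

isEq-neg-intro : ∀ {x y} → x ≢ y → 0 < neg (isEq x y)
isEq-neg-intro x≢y = subst (λ z → 0 < neg z) (sym (isEq-≢ x≢y)) z<s

isEq-neg-elim : ∀ {x y} → 0 < neg (isEq x y) → x ≢ y
isEq-neg-elim p x≡y = <-irrefl refl (subst (0 <_) (neg-of-pos (isEq-intro x≡y)) p)

truth≤1 : ∀ x → truth x ≤ 1
truth≤1 x = m∸n≤m 1 (neg x)

truth-pos : ∀ x → 0 < x → truth x ≡ 1
truth-pos x p = cong neg (neg-of-pos p)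

truth≡1 : ∀ x → truth x ≡ 1 → 0 < x
truth≡1 zero    ()
truth≡1 (suc x) _ = z<s

+-pos : ∀ a {b} → 0 < a + b → 0 < a ⊎ 0 < b
+-pos zero    p = inj₂ p
+-pos (suc a) _ = inj₁ z<s

*-pos : ∀ {a b} → 0 < a → 0 < b → 0 < a * b
*-pos = *-mono-<

*-posˡ : ∀ a {b} → 0 < a * b → 0 < a
*-posˡ (suc a) _ = z<s

*-posʳ : ∀ a {b} → 0 < a * b → 0 < b
*-posʳ a {b} p = *-posˡ b (subst (0 <_) (*-comm a b) p)

-- Bounded sums  Σ_{k<B} q k : a positive sum is a bounded existential quantifier.
bsum : ℕ → (ℕ → ℕ) → ℕ
bsum zero    q = 0
bsum (suc B) q = bsum B q + q B

BSUM : Code → Code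
BSUM Q = primrec zeroC (app₂ ADD (proj 1) Q)

conv-bsum : ∀ {Q f xs} {q : ℕ → ℕ} → (∀ k r → Conv Q f (k ∷ r ∷ xs) (q k)) →
            ∀ B → Conv (BSUM Q) f (B ∷ xs) (bsum B q)
conv-bsum {q = q} conv-Q B =
  conv-primrec (λ n → bsum n q) conv-zero (λ n → conv-app₂ conv-add (conv-proj 1) (conv-Q n _)) B

bsum-term : ∀ {B k} q → k < B → q k ≤ bsum B q
bsum-term {suc B} {k} q (s≤s k≤B) with k ≟ B
... | yes refl = m≤n+m (q k) (bsum B q)
... | no k≢B   = ≤-trans (bsum-term q (≤∧≢⇒< k≤B k≢B)) (m≤m+n (bsum B q) (q B))

bsum-intro : ∀ {B k} q → k < B → 0 < q k → 0 < bsum B q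
bsum-intro q k<B p = <-≤-trans p (bsum-term q k<B)

bsum-elim : ∀ B q → 0 < bsum B q → ∃[ k ] (k < B × 0 < q k)
bsum-elim (suc B) q p with +-pos (bsum B q) p
... | inj₁ p' = let (k , k<B , qk) = bsum-elim B q p' in k , m<n⇒m<1+n k<B , qk
... | inj₂ qB = B , ≤-refl , qB

-- Cantor pairing.  Defs writes it as ⌊(x+y)(x+y+1)/2⌋ + y; we compute and reason with
-- the equivalent triangular-number form tri (x+y) + y.
tri : ℕ → ℕ
tri zero    = 0
tri (suc n) = tri n + suc n

cantor : ℕ → ℕ → ℕ
cantor x y = tri (x + y) + y

tri-double : ∀ n → n * suc n ≡ tri n + tri n
tri-double zero    = refl
tri-double (suc n) = begin
  suc n * suc (suc n)               ≡⟨ expand n ⟩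
  n * suc n + 2 * suc n             ≡⟨ cong (_+ 2 * suc n) (tri-double n) ⟩
  tri n + tri n + 2 * suc n         ≡⟨ regroup (tri n) (suc n) ⟩
  (tri n + suc n) + (tri n + suc n) ∎
  where
  open ≡-Reasoning
  expand : ∀ n → suc n * suc (suc n) ≡ n * suc n + 2 * suc n
  expand = solve-∀
  regroup : ∀ t m → t + t + 2 * m ≡ (t + m) + (t + m)
  regroup = solve-∀

pair≡cantor : ∀ x y → pair x y ≡ cantor x y
pair≡cantor x y =
  cong (_+ y) (trans (cong ⌊_/2⌋ (tri-double (x + y))) (sym (n≡⌊n+n/2⌋ (tri (x + y)))))

tri-gap : ∀ {s s'} → s < s' → tri s + s < tri s'
tri-gap {s} (s≤s s≤s') = ≤-trans (≤-reflexive (sym (+-suc (tri s) s))) (tri-mono (s≤s s≤s'))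
  where
  tri-mono : ∀ {m n} → m ≤ n → tri m ≤ tri n
  tri-mono {m} m≤n = go (≤⇒≤′ m≤n)
    where
    go : ∀ {n} → m ≤′ n → tri m ≤ tri n
    go ≤′-refl       = ≤-refl
    go (≤′-step m≤n) = ≤-trans (go m≤n) (m≤m+n _ _)

cantor-< : ∀ {x y x' y'} → x + y < x' + y' → cantor x y < cantor x' y'
cantor-< {x} {y} {x'} {y'} lt =
  ≤-trans (s≤s (+-monoʳ-≤ (tri (x + y)) (m≤n+m y x))) (≤-trans (tri-gap lt) (m≤m+n _ y'))

cantor-injective : ∀ {x y x' y'} → cantor x y ≡ cantor x' y' → x ≡ x' × y ≡ y'
cantor-injective {x} {y} {x'} {y'} e with <-cmp (x + y) (x' + y')
... | tri< lt _ _ = ⊥-elim (<-irrefl e (cantor-< {x} {y} {x'} {y'} lt))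
... | tri> _ _ gt = ⊥-elim (<-irrefl (sym e) (cantor-< {x'} {y'} {x} {y} gt))
... | tri≈ _ s≡s' _ = x≡x' , y≡y'
  where
  y≡y' : y ≡ y'
  y≡y' = +-cancelˡ-≡ (tri (x + y)) y y' (trans e (cong (λ s → tri s + y') (sym s≡s')))
  x≡x' : x ≡ x'
  x≡x' = +-cancelʳ-≡ y x x' (trans s≡s' (cong (x' +_) (sym y≡y')))

cantor≥ˡ : ∀ x y → x ≤ cantor x y
cantor≥ˡ x y = ≤-trans (m≤m+n x y) (≤-trans (n≤tri (x + y)) (m≤m+n _ y))
  where
  n≤tri : ∀ n → n ≤ tri n
  n≤tri zero    = z≤n
  n≤tri (suc n) = m≤n+m (suc n) (tri n)

cantor≥ʳ : ∀ x y → y ≤ cantor x y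
cantor≥ʳ x y = m≤n+m y _

TRI : Code
TRI = primrec zeroC (app₂ ADD (proj 1) (app₁ succC (proj 0)))

conv-tri : ∀ {f} x → Conv TRI f (x ∷ []) (tri x)
conv-tri x = conv-primrec tri conv-zero
  (λ n → conv-app₂ conv-add (conv-proj 1) (conv-app₁ (λ _ → conv-succ) (conv-proj 0))) x

CANTOR : Code
CANTOR = app₂ ADD (app₁ TRI (app₂ ADD (proj 0) (proj 1))) (proj 1)

conv-cantor : ∀ {f} x y → Conv CANTOR f (x ∷ y ∷ []) (cantor x y)
conv-cantor x y =
  conv-app₂ conv-add (conv-app₁ conv-tri (conv-app₂ conv-add (conv-proj 0) (conv-proj 1))) (conv-proj 1)

-- We count occurrences: the k colour counts add up to 2k+1,
-- so some count is at least 3, and its 1st, 2nd and 3rd occurrences are the triple.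

bsum-+ : ∀ k (a b : ℕ → ℕ) → bsum k (λ i → a i + b i) ≡ bsum k a + bsum k b
bsum-+ zero    a b = refl
bsum-+ (suc k) a b = trans (cong (_+ (a k + b k)) (bsum-+ k a b)) (regroup (bsum k a) (bsum k b) (a k) (b k))
  where
  regroup : ∀ w x y z → w + x + (y + z) ≡ (w + y) + (x + z)
  regroup = solve-∀

bsum-swap : ∀ a b (F : ℕ → ℕ → ℕ) → bsum a (λ i → bsum b (F i)) ≡ bsum b (λ j → bsum a (λ i → F i j))
bsum-swap a zero    F = bsum-zero a
  where
  bsum-zero : ∀ a → bsum a (λ _ → 0) ≡ 0
  bsum-zero zero    = refl
  bsum-zero (suc a) = cong (_+ 0) (bsum-zero a)
bsum-swap a (suc b) F =
  trans (bsum-+ a (λ i → bsum b (F i)) (λ i → F i b)) (cong (_+ bsum a (λ i → F i b)) (bsum-swap a b F))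

bsum-ones : ∀ N (q : ℕ → ℕ) → (∀ j → q j ≡ 1) → bsum N q ≡ N
bsum-ones zero    q q≡1 = refl
bsum-ones (suc N) q q≡1 = trans (cong₂ _+_ (bsum-ones N q q≡1) (q≡1 N)) (+-comm N 1)

isEq-sum-≤ : ∀ k x → k ≤ x → bsum k (isEq x) ≡ 0
isEq-sum-≤ zero    x _   = refl
isEq-sum-≤ (suc k) x k<x = cong₂ _+_ (isEq-sum-≤ k x (<⇒≤ k<x)) (isEq-≢ (>⇒≢ k<x))

isEq-sum-< : ∀ k x → x < k → bsum k (isEq x) ≡ 1
isEq-sum-< (suc k) x x<1+k with m<1+n⇒m<n∨m≡n x<1+k
... | inj₁ x<k  = cong₂ _+_ (isEq-sum-< k x x<k) (isEq-≢ (<⇒≢ x<k))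
... | inj₂ refl = cong₂ _+_ (isEq-sum-≤ x x ≤-refl) (isEq-refl x)

count : (ℕ → ℕ) → ℕ → ℕ → ℕ
count col i N = bsum N (λ j → isEq (col j) i)

count-total : ∀ col k N → (∀ j → col j < k) → bsum k (λ i → count col i N) ≡ N
count-total col k N col<k =
  trans (bsum-swap k N (λ i j → isEq (col j) i))
        (bsum-ones N (λ j → bsum k (isEq (col j))) (λ j → isEq-sum-< k (col j) (col<k j)))

large-term : ∀ k g → 2 * k < bsum k g → ∃[ i ] (i < k × 2 < g i)
large-term (suc k) g lt with 3 ≤? g k
... | yes 2<gk = k , ≤-refl , 2<gk
... | no  gk≮3 = let (i , i<k , 2<gi) = large-term k g rest in i , m<n⇒m<1+n i<k , 2<gi
  where
  open ≤-Reasoning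
  rest : 2 * k < bsum k g
  rest = +-cancelˡ-< 2 (2 * k) (bsum k g) (begin-strict
    2 + 2 * k        ≡⟨ *-suc 2 k ⟨
    2 * suc k        <⟨ lt ⟩
    bsum k g + g k   ≤⟨ +-monoʳ-≤ (bsum k g) (≤-pred (≰⇒> gk≮3)) ⟩
    bsum k g + 2     ≡⟨ +-comm (bsum k g) 2 ⟩
    2 + bsum k g     ∎)

-- The (m+1)-st occurrence of colour i below N.
occurrence : ∀ col i m N → m < count col i N → ∃[ j ] (j < N × col j ≡ i × m ≤ count col i j)
occurrence col i m (suc N) lt with col N ≟ i
... | yes refl =
  N , ≤-refl , refl , m<1+n⇒m≤n (subst (m <_) (trans (cong (count col (col N) N +_) (isEq-refl (col N))) (+-comm _ 1)) lt)
... | no  ne   =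
  let (j , j<N , colj , m≤) = occurrence col i m N (subst (λ z → m < z) (trans (cong (count col i N +_) (isEq-≢ ne)) (+-identityʳ _)) lt)
  in j , m<n⇒m<1+n j<N , colj , m≤

pigeonhole₃ : ∀ col k → (∀ j → col j < k) →
              ∃[ i ] ∃[ j₁ ] ∃[ j₂ ] ∃[ j₃ ] (j₁ < j₂ × j₂ < j₃ × col j₁ ≡ i × col j₂ ≡ i × col j₃ ≡ i)
pigeonhole₃ col k col<k =
  let N = suc (2 * k)
      (i , _ , 2<count) = large-term k (λ i → count col i N) (subst (2 * k <_) (sym (count-total col k N col<k)) ≤-refl)
      (j₃ , _ , e₃ , 2≤) = occurrence col i 2 N 2<count
      (j₂ , j₂<j₃ , e₂ , 1≤) = occurrence col i 1 j₃ 2≤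
      (j₁ , j₁<j₂ , e₁ , _) = occurrence col i 0 j₂ 1≤
  in i , j₁ , j₂ , j₃ , j₁<j₂ , j₂<j₃ , e₁ , e₂ , e₃

step-increasing : (f : ℕ → ℕ) → (∀ j → f j < f (suc j)) → ∀ {i j} → i < j → f i < f j
step-increasing f step {i} i<j = go (≤⇒≤′ i<j)
  where
  go : ∀ {j} → suc i ≤′ j → f i < f j
  go ≤′-refl              = step i
  go (≤′-step {j} i<j) = <-trans (go i<j) (step j)

-- 2·e, written so that its value is definitionally 2 * a.
DOUBLE : Code → Code
DOUBLE e = app₂ ADD e (app₂ ADD e zeroC)

conv-double : ∀ {e f xs a} → Conv e f xs a → Conv (DOUBLE e) f xs (2 * a)
conv-double p = conv-app₂ conv-add p (conv-app₂ conv-add p conv-zero)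

-- The graph built from a colouring c.  Vertex n is named ⟨n, c n⟩, so that its colour
-- can be read off its name; two distinct vertices are adjacent iff they have the same colour.
vertex : (ℕ → ℕ) → ℕ → ℕ
vertex c n = cantor n (c n)

edgeCode : (ℕ → ℕ) → ℕ → ℕ → ℕ
edgeCode c n n' = suc (2 * cantor (vertex c n) (vertex c n'))

-- Positive iff m = 2·vertex c n for some n (necessarily n ≤ m).
vertexTest : (ℕ → ℕ) → ℕ → ℕ
vertexTest c m = bsum (suc m) λ n → isEq m (2 * vertex c n)

-- Positive iff m = edgeCode c n n' for distinct n, n' ≤ m of the same colour.
edgeTest : (ℕ → ℕ) → ℕ → ℕ
edgeTest c m = bsum (suc m) λ n → bsum (suc m) λ n' →
  isEq m (edgeCode c n n') * (neg (isEq n n') * isEq (c n) (c n'))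

colourGraph : (ℕ → ℕ) → ℕ → ℕ
colourGraph c m = truth (vertexTest c m + edgeTest c m)

VERTEX : Code → Code
VERTEX e = app₂ CANTOR e (app₁ oracle e)

conv-vertex : ∀ {e c xs n} → Conv e c xs n → Conv (VERTEX e) c xs (vertex c n)
conv-vertex p = conv-app₂ conv-cantor p (conv-app₁ (λ _ → conv-oracle) p)

VERTEXTEST : Code
VERTEXTEST = comp (BSUM (app₂ ISEQ (proj 2) (DOUBLE (VERTEX (proj 0)))))
                  (app₁ succC (proj 0) ∷ proj 0 ∷ [])

conv-vertexTest : ∀ {c} m → Conv VERTEXTEST c (m ∷ []) (vertexTest c m)
conv-vertexTest m = conv-comp (conv-∷ (conv-app₁ (λ _ → conv-succ) (conv-proj 0)) (conv-∷ (conv-proj 0) conv-[]))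
  (conv-bsum (λ n r → conv-app₂ conv-isEq (conv-proj 2) (conv-double (conv-vertex (conv-proj 0)))) _)

-- The body of edgeTest, on arguments n' ∷ r ∷ n ∷ m.
EDGEBODY : Code
EDGEBODY =
  app₂ MUL (app₂ ISEQ (proj 3) (app₁ succC (DOUBLE (app₂ CANTOR (VERTEX (proj 2)) (VERTEX (proj 0))))))
           (app₂ MUL (app₁ NEG (app₂ ISEQ (proj 2) (proj 0)))
                     (app₂ ISEQ (app₁ oracle (proj 2)) (app₁ oracle (proj 0))))

EDGETEST : Code
EDGETEST = comp (BSUM (comp (BSUM EDGEBODY) (app₁ succC (proj 2) ∷ proj 0 ∷ proj 2 ∷ [])))
                (app₁ succC (proj 0) ∷ proj 0 ∷ [])

conv-edgeTest : ∀ {c} m → Conv EDGETEST c (m ∷ []) (edgeTest c m)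
conv-edgeTest m = conv-comp (conv-∷ (conv-app₁ (λ _ → conv-succ) (conv-proj 0)) (conv-∷ (conv-proj 0) conv-[]))
  (conv-bsum (λ n r →
    conv-comp (conv-∷ (conv-app₁ (λ _ → conv-succ) (conv-proj 2)) (conv-∷ (conv-proj 0) (conv-∷ (conv-proj 2) conv-[])))
      (conv-bsum (λ n' r' → body) _)) _)
  where
  body : ∀ {c n' r n} → Conv EDGEBODY c (n' ∷ r ∷ n ∷ m ∷ []) (isEq m (edgeCode c n n') * (neg (isEq n n') * isEq (c n) (c n')))
  body = conv-app₂ conv-mul
    (conv-app₂ conv-isEq (conv-proj 3)
      (conv-app₁ (λ _ → conv-succ) (conv-double (conv-app₂ conv-cantor (conv-vertex (conv-proj 2)) (conv-vertex (conv-proj 0))))))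
    (conv-app₂ conv-mul (conv-app₁ conv-neg (conv-app₂ conv-isEq (conv-proj 2) (conv-proj 0)))
      (conv-app₂ conv-isEq (conv-app₁ (λ _ → conv-oracle) (conv-proj 2)) (conv-app₁ (λ _ → conv-oracle) (conv-proj 0))))

GRAPH : Code
GRAPH = app₁ TRUTH (app₂ ADD VERTEXTEST EDGETEST)

conv-graph : ∀ {c} m → Conv GRAPH c (m ∷ []) (colourGraph c m)
conv-graph m = conv-app₁ conv-truth (conv-app₂ conv-add (conv-vertexTest m) (conv-edgeTest m))

vertexTest-intro : ∀ c n → 0 < vertexTest c (2 * vertex c n)
vertexTest-intro c n = bsum-intro (λ k → isEq (2 * v) (2 * vertex c k)) n<2v+1 (isEq-intro {2 * v} refl)
  where
  v : ℕ
  v = vertex c n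
  n<2v+1 : n < suc (2 * v)
  n<2v+1 = s≤s (≤-trans (cantor≥ˡ n (c n)) (m≤m+n v (v + 0)))

vertexTest-elim : ∀ c m → 0 < vertexTest c m → ∃[ n ] (m ≡ 2 * vertex c n)
vertexTest-elim c m p =
  let (n , _ , q) = bsum-elim (suc m) (λ k → isEq m (2 * vertex c k)) p in n , isEq-elim q

edgeTest-intro : ∀ c n n' → n ≢ n' → c n ≡ c n' → 0 < edgeTest c (edgeCode c n n')
edgeTest-intro c n n' n≢n' cn≡cn' =
  bsum-intro (λ k → bsum (suc m) (λ k' → body k k')) (below n (cantor≥ˡ (vertex c n) (vertex c n')))
    (bsum-intro (body n) (below n' (cantor≥ʳ (vertex c n) (vertex c n'))) body-pos)
  where
  m : ℕ
  m = edgeCode c n n'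
  body : ℕ → ℕ → ℕ
  body k k' = isEq m (edgeCode c k k') * (neg (isEq k k') * isEq (c k) (c k'))
  below : ∀ k → vertex c k ≤ cantor (vertex c n) (vertex c n') → k < suc m
  below k le = s≤s (≤-trans (cantor≥ˡ k (c k)) (≤-trans le (≤-trans (m≤m+n _ _) (n≤1+n _))))
  body-pos : 0 < body n n'
  body-pos = *-pos (isEq-intro {m} refl) (*-pos (isEq-neg-intro n≢n') (isEq-intro cn≡cn'))

edgeTest-elim : ∀ c m → 0 < edgeTest c m →
                ∃[ n ] ∃[ n' ] (m ≡ edgeCode c n n' × n ≢ n' × c n ≡ c n')
edgeTest-elim c m p =
  let (n , _ , p₁) = bsum-elim (suc m) (λ k → bsum (suc m) (body k)) p
      (n' , _ , p₂) = bsum-elim (suc m) (body n) p₁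
      colours = *-posʳ (isEq m (edgeCode c n n')) p₂
  in n , n' , isEq-elim (*-posˡ _ p₂) ,
     isEq-neg-elim (*-posˡ (neg (isEq n n')) colours) ,
     isEq-elim (*-posʳ (neg (isEq n n')) colours)
  where
  body : ℕ → ℕ → ℕ
  body k k' = isEq m (edgeCode c k k') * (neg (isEq k k') * isEq (c k) (c k'))

module ColourGraph (c : ℕ → ℕ) where

  G : ℕ → ℕ
  G = colourGraph c

  G-intro : ∀ m → 0 < vertexTest c m ⊎ 0 < edgeTest c m → G m ≡ 1
  G-intro m (inj₁ p) = truth-pos (vertexTest c m + edgeTest c m) (<-≤-trans p (m≤m+n (vertexTest c m) (edgeTest c m)))
  G-intro m (inj₂ p) = truth-pos (vertexTest c m + edgeTest c m) (<-≤-trans p (m≤n+m (edgeTest c m) (vertexTest c m)))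

  G-elim : ∀ m → G m ≡ 1 → 0 < vertexTest c m ⊎ 0 < edgeTest c m
  G-elim m e = +-pos (vertexTest c m) (truth≡1 (vertexTest c m + edgeTest c m) e)

  vertex-in : ∀ n → Vtx G (vertex c n)
  vertex-in n = G-intro (2 * vertex c n) (inj₁ (vertexTest-intro c n))

  vertex-elim : ∀ x → Vtx G x → ∃[ n ] (x ≡ vertex c n)
  vertex-elim x e with G-elim (2 * x) e
  ... | inj₁ p = let (n , 2x≡2v) = vertexTest-elim c (2 * x) p in n , *-cancelˡ-≡ x (vertex c n) 2 2x≡2v
  ... | inj₂ p = let (n , n' , 2x≡odd , _) = edgeTest-elim c (2 * x) p in ⊥-elim (even≢odd x (cantor (vertex c n) (vertex c n')) 2x≡odd)

  edge-intro : ∀ n n' → n ≢ n' → c n ≡ c n' → Edge G (vertex c n) (vertex c n')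
  edge-intro n n' n≢n' cn≡cn' =
    subst (λ P → G (suc (2 * P)) ≡ 1) (sym (pair≡cantor (vertex c n) (vertex c n')))
          (G-intro (edgeCode c n n') (inj₂ (edgeTest-intro c n n' n≢n' cn≡cn')))

  edge-elim : ∀ x y → Edge G x y →
              ∃[ n ] ∃[ n' ] (x ≡ vertex c n × y ≡ vertex c n' × n ≢ n' × c n ≡ c n')
  edge-elim x y e with G-elim (suc (2 * cantor x y)) (subst (λ P → G (suc (2 * P)) ≡ 1) (pair≡cantor x y) e)
  ... | inj₁ p = let (n , odd≡2v) = vertexTest-elim c _ p in ⊥-elim (even≢odd (vertex c n) (cantor x y) (sym odd≡2v))
  ... | inj₂ p =
    let (n , n' , code≡ , n≢n' , cn≡cn') = edgeTest-elim c _ p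
        (x≡ , y≡) = cantor-injective {x} {y} (*-cancelˡ-≡ _ _ 2 (suc-injective code≡))
    in n , n' , x≡ , y≡ , n≢n' , cn≡cn'

  isGraph : IsGraph G
  isGraph = (λ m → truth≤1 (vertexTest c m + edgeTest c m)) , symmetric , irreflexive , endpoints , infinite
    where
    symmetric : ∀ x y → Edge G x y → Edge G y x
    symmetric x y e with edge-elim x y e
    ... | n , n' , refl , refl , n≢n' , cn≡cn' = edge-intro n' n (≢-sym n≢n') (sym cn≡cn')
    irreflexive : ∀ x → ¬ Edge G x x
    irreflexive x e with edge-elim x x e
    ... | n , n' , x≡ , x≡' , n≢n' , _ = n≢n' (proj₁ (cantor-injective {n} {c n} (trans (sym x≡) x≡')))
    endpoints : ∀ x y → Edge G x y → Vtx G x × Vtx G y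
    endpoints x y e with edge-elim x y e
    ... | n , n' , refl , refl , _ = vertex-in n , vertex-in n'
    infinite : Infinite (Vtx G)
    infinite N = vertex c N , cantor≥ˡ N (c N) , vertex-in N

allIn : (ℕ → ℕ) → ℕ → ℕ → ℕ → ℕ → ℕ
allIn h i n₁ n₂ n₃ = h (cantor n₁ i) * (h (cantor n₂ i) * h (cantor n₃ i))

triples : (ℕ → ℕ) → ℕ → ℕ → ℕ
triples h i s = bsum s λ n₃ → bsum n₃ λ n₂ → bsum n₂ λ n₁ → allIn h i n₁ n₂ n₃

someTriple : (ℕ → ℕ) → ℕ → ℕ
someTriple h s = bsum s λ i → triples h i s

triples-intro : ∀ h i {n₁ n₂ n₃ s} → n₁ < n₂ → n₂ < n₃ → n₃ < s →
                0 < h (cantor n₁ i) → 0 < h (cantor n₂ i) → 0 < h (cantor n₃ i) → 0 < triples h i s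
triples-intro h i {n₁} {n₂} {n₃} n₁<n₂ n₂<n₃ n₃<s p₁ p₂ p₃ =
  bsum-intro (λ m₃ → bsum m₃ λ m₂ → bsum m₂ λ m₁ → allIn h i m₁ m₂ m₃) n₃<s
    (bsum-intro (λ m₂ → bsum m₂ λ m₁ → allIn h i m₁ m₂ n₃) n₂<n₃
      (bsum-intro (λ m₁ → allIn h i m₁ n₂ n₃) n₁<n₂ (*-pos p₁ (*-pos p₂ p₃))))

ColumnTriple : (ℕ → ℕ) → ℕ → Set
ColumnTriple h i = ∃[ n₁ ] ∃[ n₂ ] ∃[ n₃ ] (n₁ < n₂ × n₂ < n₃ ×
                     0 < h (cantor n₁ i) × 0 < h (cantor n₂ i) × 0 < h (cantor n₃ i))

triples-elim : ∀ h i s → 0 < triples h i s → ColumnTriple h i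
triples-elim h i s p =
  let (n₃ , _ , p₃) = bsum-elim s (λ m₃ → bsum m₃ λ m₂ → bsum m₂ λ m₁ → allIn h i m₁ m₂ m₃) p
      (n₂ , n₂<n₃ , p₂) = bsum-elim n₃ (λ m₂ → bsum m₂ λ m₁ → allIn h i m₁ m₂ n₃) p₃
      (n₁ , n₁<n₂ , p₁) = bsum-elim n₂ (λ m₁ → allIn h i m₁ n₂ n₃) p₂
      p₂₃ = *-posʳ (h (cantor n₁ i)) p₁
  in n₁ , n₂ , n₃ , n₁<n₂ , n₂<n₃ , *-posˡ _ p₁ , *-posˡ _ p₂₃ , *-posʳ (h (cantor n₂ i)) p₂₃

TRIPLES : Code
TRIPLES =
  BSUM (comp (BSUM (comp (BSUM (app₂ MUL (app₁ oracle (app₂ CANTOR (proj 0) (proj 4)))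
                                        (app₂ MUL (app₁ oracle (app₂ CANTOR (proj 2) (proj 4)))
                                                  (app₁ oracle (app₂ CANTOR (proj 3) (proj 4))))))
                         (proj 0 ∷ proj 0 ∷ proj 2 ∷ proj 3 ∷ [])))
             (proj 0 ∷ proj 0 ∷ proj 2 ∷ []))

conv-triples : ∀ {h} s i → Conv TRIPLES h (s ∷ i ∷ []) (triples h i s)
conv-triples s i =
  conv-bsum (λ n₃ r → conv-comp (conv-∷ (conv-proj 0) (conv-∷ (conv-proj 0) (conv-∷ (conv-proj 2) conv-[])))
    (conv-bsum (λ n₂ r′ → conv-comp (conv-∷ (conv-proj 0) (conv-∷ (conv-proj 0) (conv-∷ (conv-proj 2) (conv-∷ (conv-proj 3) conv-[]))))
      (conv-bsum (λ n₁ r″ → conv-app₂ conv-mul (member (conv-proj 0))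
                                               (conv-app₂ conv-mul (member (conv-proj 2)) (member (conv-proj 3)))) _)) _)) s
  where
  member : ∀ {h e xs n} → Conv e h xs n → Conv (app₁ oracle (app₂ CANTOR e (proj 4))) h xs (h (cantor n (nth 4 xs)))
  member p = conv-app₁ (λ _ → conv-oracle) (conv-app₂ conv-cantor p (conv-proj 4))

SOMETRIPLE : Code
SOMETRIPLE = comp (BSUM (comp TRIPLES (proj 2 ∷ proj 0 ∷ []))) (proj 0 ∷ proj 0 ∷ [])

conv-someTriple : ∀ {h} s xs → Conv SOMETRIPLE h (s ∷ xs) (someTriple h s)
conv-someTriple s xs = conv-comp (conv-∷ (conv-proj 0) (conv-∷ (conv-proj 0) conv-[]))
  (conv-bsum (λ i r → conv-comp (conv-∷ (conv-proj 2) (conv-∷ (conv-proj 0) conv-[])) (conv-triples _ _)) s)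

CONST : Code → Code
CONST e = comp e []

conv-const : ∀ {e f xs v} → Conv e f [] v → Conv (CONST e) f xs v
conv-const p = conv-comp conv-[] p

-- STAGE is a stage s at which a triple of one colour has appeared;
-- COLOUR is a colour i having a triple below STAGE.
STAGE : Code
STAGE = CONST (mu (app₁ NEG SOMETRIPLE))

COLOUR : Code
COLOUR = CONST (mu (app₁ NEG (comp TRIPLES (STAGE ∷ proj 0 ∷ []))))

PSI : Code
PSI = app₁ oracle (app₂ CANTOR (proj 0) COLOUR)

conv-stage-body : ∀ {h} k → Conv (app₁ NEG SOMETRIPLE) h (k ∷ []) (neg (someTriple h k))
conv-stage-body k = conv-app₁ conv-neg (conv-someTriple k [])

conv-colour-body : ∀ {h t} → Conv (mu (app₁ NEG SOMETRIPLE)) h [] t →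
                   ∀ k → Conv (app₁ NEG (comp TRIPLES (STAGE ∷ proj 0 ∷ []))) h (k ∷ []) (neg (triples h k t))
conv-colour-body stage k =
  conv-app₁ conv-neg (conv-comp (conv-∷ (conv-const stage) (conv-∷ (conv-proj 0) conv-[])) (conv-triples _ k))

psi-converges : ∀ h s → 0 < someTriple h s →
                ∃[ a ] (ColumnTriple h a × (∀ n → Conv PSI h (n ∷ []) (h (cantor n a))))
psi-converges h s p
  with conv-mu (λ k → neg (someTriple h k)) conv-stage-body s (neg-of-pos p)
... | t , stage , t-found
  with bsum-elim t (λ i → triples h i t) (neg≡0 (someTriple h t) t-found)
... | i , _ , i-found
  with conv-mu (λ k → neg (triples h k t)) (conv-colour-body stage) i (neg-of-pos i-found)
... | a , colour , a-found =
  a , triples-elim h a t (neg≡0 (triples h a t) a-found) ,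
  λ n → conv-app₁ (λ _ → conv-oracle) (conv-app₂ conv-cantor (conv-proj 0) (conv-const colour))

-- Fix a colouring c with colours below k and a wRSg-solution h of its
-- colour graph.  By the pigeonhole principle H contains three vertices of one colour, so Ψ
-- converges to a colour a with three H-vertices ⟨m₁,a⟩, ⟨m₂,a⟩, ⟨m₃,a⟩.  Then ⟨m₁,a⟩ has
-- two H-neighbours, hence infinitely many, and they form the infinite column {n | ⟨n,a⟩ ∈ H}.
module Backward (c : ℕ → ℕ) (k : ℕ) (c<k : ∀ n → c n < k)
                (h : ℕ → ℕ) (sol : wRSgSol (colourGraph c) h) where
  open ColourGraph c

  h≤1 : IsChar h
  h≤1 = proj₁ sol

  H⊆V : ∀ x → h x ≡ 1 → Vtx G x
  H⊆V = proj₁ (proj₂ sol)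

  H-infinite : Infinite (λ x → h x ≡ 1)
  H-infinite = proj₁ (proj₂ (proj₂ sol))

  H-weakly-Ramsey : ∀ v → h v ≡ 1 → Infinite (λ y → h y ≡ 1 × Edge G v y)
                    ⊎ (∀ y z → h y ≡ 1 → Edge G v y → h z ≡ 1 → Edge G v z → y ≡ z)
  H-weakly-Ramsey = proj₂ (proj₂ (proj₂ sol))

  in-H : ∀ {x} → 0 < h x → h x ≡ 1
  in-H {x} p = ≤-antisym (h≤1 x) p

  -- A member ⟨m, a⟩ of H is the vertex of m, so a is the colour of m.
  member-colour : ∀ m a → h (cantor m a) ≡ 1 → c m ≡ a
  member-colour m a e with vertex-elim (cantor m a) (H⊆V _ e)
  ... | n , ⟨m,a⟩≡⟨n,cn⟩ with cantor-injective {m} {a} {n} {c n} ⟨m,a⟩≡⟨n,cn⟩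
  ... | refl , a≡cn = sym a≡cn

  member-above : ∀ n → ∃[ n' ] (n < n' × h (vertex c n') ≡ 1)
  member-above n with H-infinite (cantor (suc n) k)
  ... | x , bound≤x , x∈H with vertex-elim x (H⊆V x x∈H)
  ... | n' , refl = n' , ≰⇒> too-small , x∈H
    where
    -- if n' ≤ n then vertex c n' lies below the bound ⟨n+1, k⟩
    too-small : n' ≰ n
    too-small n'≤n = <-irrefl refl (<-≤-trans (cantor-< {n'} {c n'} {suc n} {k} (s≤s (+-mono-≤ n'≤n (<⇒≤ (c<k n'))))) bound≤x)

  seq : ℕ → ℕ
  seq zero    = proj₁ (member-above 0)
  seq (suc j) = proj₁ (member-above (seq j))

  seq-in-H : ∀ j → h (vertex c (seq j)) ≡ 1
  seq-in-H zero    = proj₂ (proj₂ (member-above 0))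
  seq-in-H (suc j) = proj₂ (proj₂ (member-above (seq j)))

  seq-increasing : ∀ {i j} → i < j → seq i < seq j
  seq-increasing = step-increasing seq (λ j → proj₁ (proj₂ (member-above (seq j))))

  triple-stage : ∃[ s ] (0 < someTriple h s)
  triple-stage with pigeonhole₃ (λ j → c (seq j)) k (λ j → c<k (seq j))
  ... | i , j₁ , j₂ , j₃ , j₁<j₂ , j₂<j₃ , e₁ , e₂ , e₃ =
    suc (seq j₃ + i) ,
    bsum-intro (λ i′ → triples h i′ (suc (seq j₃ + i))) (s≤s (m≤n+m i (seq j₃)))
      (triples-intro h i (seq-increasing j₁<j₂) (seq-increasing j₂<j₃) (s≤s (m≤m+n (seq j₃) i))
        (in-column j₁ e₁) (in-column j₂ e₂) (in-column j₃ e₃))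
    where
    in-column : ∀ j → c (seq j) ≡ i → 0 < h (cantor (seq j) i)
    in-column j e = subst (λ x → 0 < h (cantor (seq j) x)) e (≤-reflexive (sym (seq-in-H j)))

  column-solution : ∀ a → ColumnTriple h a → RT1Sol c (λ n → h (cantor n a))
  column-solution a (m₁ , m₂ , m₃ , m₁<m₂ , m₂<m₃ , p₁ , p₂ , p₃) =
    (λ n → h≤1 (cantor n a)) , column-infinite ,
    (λ x y hx hy → trans (member-colour x a hx) (sym (member-colour y a hy)))
    where
    h₁ : h (cantor m₁ a) ≡ 1
    h₁ = in-H p₁
    h₂ : h (cantor m₂ a) ≡ 1
    h₂ = in-H p₂
    h₃ : h (cantor m₃ a) ≡ 1
    h₃ = in-H p₃
    v : ℕ
    v = cantor m₁ a
    edge-to : ∀ m → m₁ ≢ m → h (cantor m a) ≡ 1 → Edge G v (cantor m a)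
    edge-to m m₁≢m hm =
      subst₂ (Edge G) (cong (cantor m₁) (member-colour m₁ a h₁)) (cong (cantor m) (member-colour m a hm))
             (edge-intro m₁ m m₁≢m (trans (member-colour m₁ a h₁) (sym (member-colour m a hm))))
    many-neighbours : Infinite (λ y → h y ≡ 1 × Edge G v y)
    many-neighbours with H-weakly-Ramsey v h₁
    ... | inj₁ infinite = infinite
    ... | inj₂ unique   = ⊥-elim (<⇒≢ m₂<m₃ (proj₁ (cantor-injective {m₂} {a} {m₃} {a}
            (unique _ _ h₂ (edge-to m₂ (<⇒≢ m₁<m₂) h₂) h₃ (edge-to m₃ (<⇒≢ (<-trans m₁<m₂ m₂<m₃)) h₃)))))
    -- every neighbour of v in H is ⟨q,a⟩; those beyond ⟨N,a⟩ have q ≥ N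
    column-infinite : Infinite (λ n → h (cantor n a) ≡ 1)
    column-infinite N with many-neighbours (cantor N a)
    ... | y , ⟨N,a⟩≤y , y∈H , v~y with edge-elim v y v~y
    ... | q₁ , q , v≡⟨q₁,cq₁⟩ , refl , _ , cq₁≡cq = q , N≤q , subst (λ x → h (cantor q x) ≡ 1) cq≡a y∈H
      where
      cq≡a : c q ≡ a
      cq≡a = trans (sym cq₁≡cq) (sym (proj₂ (cantor-injective {m₁} {a} {q₁} {c q₁} v≡⟨q₁,cq₁⟩)))
      N≤q : N ≤ q
      N≤q = ≮⇒≥ λ q<N → <-irrefl refl
        (<-≤-trans (cantor-< {q} {a} {N} {a} (+-monoˡ-< a q<N)) (subst (cantor N a ≤_) (cong (cantor q) cq≡a) ⟨N,a⟩≤y))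

  backward : ∃[ a ] ((∀ n → Conv PSI h (n ∷ []) (h (cantor n a))) × RT1Sol c (λ n → h (cantor n a)))
  backward = from-colour (psi-converges h (proj₁ triple-stage) (proj₂ triple-stage))
    where
    from-colour : ∃[ a ] (ColumnTriple h a × (∀ n → Conv PSI h (n ∷ []) (h (cantor n a)))) →
                  ∃[ a ] ((∀ n → Conv PSI h (n ∷ []) (h (cantor n a))) × RT1Sol c (λ n → h (cantor n a)))
    from-colour (a , triple , psi-conv) = a , psi-conv , column-solution a triple

proposition6p10 : RT1<∞ ≤sW wRSg
proposition6p10 = GRAPH , PSI , λ c (k , c<k) →
  colourGraph c , (λ m → conv-↓ (conv-graph m)) , ColourGraph.isGraph c , λ h sol →
    let (a , psi-conv , solution) = Backward.backward c k c<k h sol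
    in (λ n → h (cantor n a)) , (λ n → conv-↓ (psi-conv n)) , solution
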